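{- Let $M_1\in\mathbb{Z}^{m\times m}$ be nonsingular, $M_2\in\mathbb{Z}^{k\times m}$ and $F\in\mathbb{Z}^{n\times m}$. If $(S,W)$ is a Smith massager for $M_1$, then $\mathcal{R}\left( \begin{bmatrix} M_1 \\ M_2 \end{bmatrix},F\right ) = \mathcal{R} \left( \begin{bmatrix} S \\ \operatorname{colmod}(M_2W,S) \end{bmatrix},\operatorname{colmod}(FW,S)\right).$
   Context: For $M$ of full column rank and $F$ with the same number of columns, $\mathcal{R}(M,F)=\{p\in\mathbb{Z}^{1\times n}: pF=qM\text{ for some integer row vector } q\}$. For a nonsingular nonnegative diagonal $S$, $\operatorname{colmod}(X,S)$ replaces each entry in column $j$ of $X$ by its residue in $[0,S_{jj})$ modulo $S_{jj}$. Let $M_1\in\mathbb{Z}^{m\times m}$ be nonsingular with Smith form $S$ (the unique diagonal matrix with positive diagonal entries $s_1\mid\cdots\mid s_m$ equal to $UM_1V$ for unimodular $U,V$). A pair $(S,W)$ with $W\in\mathbb{Z}^{m\times m}$ is a Smith massager for $M_1$ if (i) $M_1W\equiv 0 \bmod S$, i.e. every entry in column $j$ of $M_1W$ is divisible by $s_j$, and (ii) there exists $Z\in\mathbb{Z}^{m\times m}$ with $ZW\equiv I_m\bmod S$ (entrywise congruence of column $j$ modulo $s_j$). -}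

module Defs where

open import Data.Nat as ℕ using (ℕ; zero; suc)
open import Data.Integer using (ℤ; +_; _+_; _*_; -_; _-_; _%ℕ_)
open import Data.Integer.Divisibility using (_∣_)
open import Data.Fin using (Fin; zero; suc; punchIn; splitAt; toℕ)
open import Data.Sum using ([_,_])
open import Data.Product using (Σ; _×_; ∃)
open import Relation.Binary.PropositionalEquality using (_≡_; _≢_)
open import Relation.Nullary using (Dec; yes; no)
open import Function.Bundles using (_⇔_)

Matrix : ℕ → ℕ → Set
Matrix r c = Fin r → Fin c → ℤ

RowVec : ℕ → Set
RowVec n = Fin n → ℤ

Σ[<_] : (n : ℕ) → (Fin n → ℤ) → ℤ
Σ[< zero ] f = + 0
Σ[< suc n ] f = f zero + Σ[< n ] (λ i → f (suc i))

_≋_ : ∀ {r c} → Matrix r c → Matrix r c → Set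
A ≋ B = ∀ i j → A i j ≡ B i j

_⊗_ : ∀ {r n c} → Matrix r n → Matrix n c → Matrix r c
_⊗_ {n = n} A B i j = Σ[< n ] (λ l → A i l * B l j)

_·ᵥ_ : ∀ {n c} → RowVec n → Matrix n c → RowVec c
_·ᵥ_ {n = n} p A j = Σ[< n ] (λ l → p l * A l j)

diag : ∀ {m} → (Fin m → ℤ) → Matrix m m
diag d i j with i Data.Fin.≟ j
... | yes _ = d i
... | no _  = + 0

I : ∀ {m} → Matrix m m
I = diag (λ _ → + 1)

stack : ∀ {r k c} → Matrix r c → Matrix k c → Matrix (r ℕ.+ k) c
stack {r} A B i j = [ (λ a → A a j) , (λ b → B b j) ] (splitAt r i)

sign : ℕ → ℤ
sign zero = + 1
sign (suc zero) = - (+ 1)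
sign (suc (suc n)) = sign n

det : ∀ {m} → Matrix m m → ℤ
det {zero} A = + 1
det {suc m} A =
  Σ[< suc m ] (λ j → sign (toℕ j) * (A zero j * det (λ a b → A (suc a) (punchIn j b))))

Nonsingular : ∀ {m} → Matrix m m → Set
Nonsingular A = det A ≢ + 0

Unimodular : ∀ {m} → Matrix m m → Set
Unimodular {m} U = Σ (Matrix m m) λ U' → ((U ⊗ U') ≋ I) × ((U' ⊗ U) ≋ I)

IsSmithForm : ∀ {m} → Matrix m m → (Fin m → ℕ) → Set
IsSmithForm {m} M s =
  (∀ j → 0 ℕ.< s j) ×
  (∀ (i j : Fin m) → toℕ j ≡ suc (toℕ i) → (+ s i) ∣ (+ s j)) ×
  Σ (Matrix m m) λ U → Σ (Matrix m m) λ V →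
    Unimodular U × Unimodular V × (((U ⊗ M) ⊗ V) ≋ diag (λ j → + s j))

ColCong : ∀ {r m} → Matrix r m → Matrix r m → (Fin m → ℕ) → Set
ColCong X Y s = ∀ i j → (+ s j) ∣ (X i j - Y i j)

O : ∀ {r c} → Matrix r c
O _ _ = + 0

IsSmithMassager : ∀ {m} → Matrix m m → (Fin m → ℕ) → Matrix m m → Set
IsSmithMassager {m} M₁ s W =
  ColCong (M₁ ⊗ W) O s ×
  Σ (Matrix m m) λ Z → ColCong (Z ⊗ W) I s

-- Residue of x in [0, d) modulo d (d > 0); for d = 0 (never used, S nonsingular) x itself.
modz : ℤ → ℕ → ℤ
modz x zero = x
modz x (suc d) = + (x %ℕ suc d)

colmod : ∀ {r m} → Matrix r m → (Fin m → ℕ) → Matrix r m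
colmod X s i j = modz (X i j) (s j)

InR : ∀ {r n c} → Matrix r c → Matrix n c → RowVec n → Set
InR {r} M F p = Σ (RowVec r) λ q → ∀ j → (p ·ᵥ F) j ≡ (q ·ᵥ M) j

diagℕ : ∀ {m} → (Fin m → ℕ) → Matrix m m
diagℕ s = diag (λ j → + s j)

-- The row lattice of M₁ consists exactly of the v with vW ≡ 0 (cmod S). One inclusion is
-- M₁W ≡ 0; for the other write UM₁V = S and pass to w = vV. With X = V⁻¹W and Y = ZV one has
-- SX ≡ 0 and YX ≡ I (cmod S), so w ↦ wX is a well-defined self-map of the finite group
-- ℤᵐ/ℤᵐS with a right inverse, hence injective; thus vW = wX ≡ 0 forces w ∈ ℤᵐS, i.e.
-- v ∈ ℤᵐM₁. Now pF = q₁M₁ + q₂M₂ is solvable iff (pF − q₂M₂)W ≡ 0 (cmod S) for some q₂.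
-- Replacing FW and M₂W by their column-wise residues modulo S does not change this condition,
-- which then says that p·colmod(FW,S) − q₂·colmod(M₂W,S) lies in the row lattice of S.
module Submission where

open import Defs
open import Data.Fin as Fin
  using (Fin; zero; suc; _↑ˡ_; _↑ʳ_; toℕ; fromℕ<; combine; remQuot; punchOut)
open import Data.Fin.Properties
  using (suc-injective; toℕ-injective; toℕ-fromℕ<; toℕ<n; remQuot-combine; combine-remQuot;
         punchOut-injective; injective⇒≤; any?)
open import Data.Integer using (ℤ; +_; _+_; _*_; -_; _-_; _%ℕ_; _/ℕ_; ∣_∣; _⊖_)
open import Data.Integer.DivMod using (a≡a%ℕn+[a/ℕn]*n; n%ℕd<d)
import Data.Integer.Divisibility.Signed as Signed
import Data.Integer.Properties as ℤ
open import Algebra.Properties.Semiring.Sum ℤ.+-*-semiring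
  using (sum; sum-cong-≗; sum-replicate-zero; ∑-comm; *-distribˡ-sum; *-distribʳ-sum)
open import Data.Integer.Tactic.RingSolver using (solve-∀)
open import Data.Nat as ℕ using (ℕ; zero; suc; NonZero)
open import Data.Nat.DivMod using (m<n⇒m%n≡m)
import Data.Nat.Properties as ℕ
open import Data.Product using (Σ; ∃-syntax; _,_; proj₁; proj₂)
open import Data.Product.Function.Dependent.Propositional using (Σ-⇔)
open import Data.Vec.Functional using (take; drop; _++_; _∷_; foldr)
open import Data.Vec.Functional.Properties using (lookup-++ˡ; lookup-++ʳ)
open import Function.Base using (_∘_)
open import Function.Bundles using (_⇔_; mk⇔; Equivalence)
open import Function.Construct.Identity using (↠-id)
open import Function.Definitions using (Injective)
open import Function.Properties.Equivalence using (⇔-setoid)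
open import Level using (0ℓ)
open import Relation.Binary.Bundles using (Setoid)
open import Relation.Binary.PropositionalEquality
import Relation.Binary.Reasoning.Setoid as ≈-Reasoning
open import Relation.Nullary using (contradiction; yes; no)

-- Congruences modulo a natural number

infix 4 _≡_[mod_]

record _≡_[mod_] (x y : ℤ) (d : ℕ) : Set where
  constructor ≡[mod]
  field
    quotient : ℤ
    equality : x ≡ y + quotient * + d

module _ {d : ℕ} where

  mod-refl : ∀ {x} → x ≡ x [mod d ]
  mod-refl {x} = ≡[mod] (+ 0) (sym (ℤ.+-identityʳ x))

  mod-reflexive : ∀ {x y} → x ≡ y → x ≡ y [mod d ]
  mod-reflexive refl = mod-refl

  mod-sym : ∀ {x y} → x ≡ y [mod d ] → y ≡ x [mod d ]
  mod-sym {y = y} (≡[mod] t refl) = ≡[mod] (- t) (sym (cancel y t (+ d)))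
    where
    cancel : ∀ y t D → (y + t * D) + - t * D ≡ y
    cancel = solve-∀

  mod-trans : ∀ {x y z} → x ≡ y [mod d ] → y ≡ z [mod d ] → x ≡ z [mod d ]
  mod-trans {z = z} (≡[mod] t refl) (≡[mod] u refl) = ≡[mod] (u + t) (collect z t u (+ d))
    where
    collect : ∀ z t u D → (z + u * D) + t * D ≡ z + (u + t) * D
    collect = solve-∀

  mod-setoid : Setoid _ _
  mod-setoid = record
    { Carrier = ℤ
    ; _≈_ = _≡_[mod d ]
    ; isEquivalence = record { refl = mod-refl ; sym = mod-sym ; trans = mod-trans }
    }

  mod-+-cong : ∀ {x x′ y y′} → x ≡ x′ [mod d ] → y ≡ y′ [mod d ] → x + y ≡ x′ + y′ [mod d ]
  mod-+-cong {x′ = x′} {y′ = y′} (≡[mod] t refl) (≡[mod] u refl) =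
    ≡[mod] (t + u) (collect x′ y′ t u (+ d))
    where
    collect : ∀ x y t u D → (x + t * D) + (y + u * D) ≡ (x + y) + (t + u) * D
    collect = solve-∀

  mod-minus-cong : ∀ {x x′ y y′} → x ≡ x′ [mod d ] → y ≡ y′ [mod d ] → x - y ≡ x′ - y′ [mod d ]
  mod-minus-cong {x′ = x′} {y′ = y′} (≡[mod] t refl) (≡[mod] u refl) =
    ≡[mod] (t - u) (collect x′ y′ t u (+ d))
    where
    collect : ∀ x y t u D → (x + t * D) - (y + u * D) ≡ (x - y) + (t - u) * D
    collect = solve-∀

  mod-*-congˡ : ∀ c {x y} → x ≡ y [mod d ] → c * x ≡ c * y [mod d ]
  mod-*-congˡ c {y = y} (≡[mod] t refl) = ≡[mod] (c * t) (expand c y t (+ d))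
    where
    expand : ∀ c y t D → c * (y + t * D) ≡ c * y + (c * t) * D
    expand = solve-∀

  x≡y⇒x-y≡0 : ∀ {x y} → x ≡ y [mod d ] → x - y ≡ + 0 [mod d ]
  x≡y⇒x-y≡0 {y = y} (≡[mod] t refl) = ≡[mod] t (cancel y t (+ d))
    where
    cancel : ∀ y t D → (y + t * D) - y ≡ + 0 + t * D
    cancel = solve-∀

  x-y≡0⇒x≡y : ∀ {x y} → x - y ≡ + 0 [mod d ] → x ≡ y [mod d ]
  x-y≡0⇒x≡y {x} {y} (≡[mod] t x-y≡td) = ≡[mod] t (begin
    x                    ≡⟨ regroup x y ⟩
    y + (x - y)          ≡⟨ cong (_+_ y) x-y≡td ⟩
    y + (+ 0 + t * + d)  ≡⟨ cong (_+_ y) (ℤ.+-identityˡ (t * + d)) ⟩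
    y + t * + d          ∎)
    where
    open ≡-Reasoning
    regroup : ∀ x y → x ≡ y + (x - y)
    regroup = solve-∀

  mod-%ℕ : ∀ x .{{_ : NonZero d}} → x ≡ + (x %ℕ d) [mod d ]
  mod-%ℕ x = ≡[mod] (x /ℕ d) (a≡a%ℕn+[a/ℕn]*n x d)

  modz-≡ : 0 ℕ.< d → ∀ x → modz x d ≡ x [mod d ]
  modz-≡ ℕ.z<s x = mod-sym (mod-%ℕ x)

  residue-unique : ∀ {a b} → a ℕ.< d → b ℕ.< d → + a ≡ + b [mod d ] → a ≡ b
  residue-unique {a} {b} a<d b<d (≡[mod] t a≡b+td) = ℤ.+-injective
    (trans a≡b+td (trans (cong (λ u → + b + u * + d) (ℤ.∣i∣≡0⇒i≡0 {t} ∣t∣≡0)) (ℤ.+-identityʳ (+ b))))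
    where
    a-b≡td : + a - + b ≡ t * + d
    a-b≡td = trans (cong (_- + b) a≡b+td) (cancel (+ b) (t * + d))
      where
      cancel : ∀ b z → (b + z) - b ≡ z
      cancel = solve-∀
    ∣t∣*d<1*d : ∣ t ∣ ℕ.* d ℕ.< 1 ℕ.* d
    ∣t∣*d<1*d = begin-strict
      ∣ t ∣ ℕ.* d    ≡⟨ ℤ.abs-* t (+ d) ⟨
      ∣ t * + d ∣    ≡⟨ cong ∣_∣ a-b≡td ⟨
      ∣ + a - + b ∣  ≡⟨ cong ∣_∣ (ℤ.[+m]-[+n]≡m⊖n a b) ⟩
      ∣ a ⊖ b ∣      ≤⟨ ℤ.∣m⊝n∣≤m⊔n a b ⟩
      a ℕ.⊔ b        <⟨ ℕ.⊔-lub a<d b<d ⟩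
      d              ≡⟨ ℕ.*-identityˡ d ⟨
      1 ℕ.* d        ∎
      where open ℕ.≤-Reasoning
    ∣t∣≡0 : ∣ t ∣ ≡ 0
    ∣t∣≡0 = ℕ.n<1⇒n≡0 (ℕ.*-cancelʳ-< d ∣ t ∣ 1 ∣t∣*d<1*d)

Σ≡sum : ∀ {n} (f : Fin n → ℤ) → Σ[< n ] f ≡ sum f
Σ≡sum {zero} f = refl
Σ≡sum {suc n} f = cong (_+_ (f zero)) (Σ≡sum (f ∘ suc))

Σ-cong : ∀ {n} {f g : Fin n → ℤ} → f ≗ g → Σ[< n ] f ≡ Σ[< n ] g
Σ-cong {f = f} {g} f≗g = trans (Σ≡sum f) (trans (sum-cong-≗ f≗g) (sym (Σ≡sum g)))

Σ-zero : ∀ n → Σ[< n ] (λ _ → + 0) ≡ + 0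
Σ-zero n = trans (Σ≡sum {n} (λ _ → + 0)) (sum-replicate-zero n)

Σ-distrib-minus : ∀ {n} (f g : Fin n → ℤ) → Σ[< n ] (λ i → f i - g i) ≡ Σ[< n ] f - Σ[< n ] g
Σ-distrib-minus {zero} f g = refl
Σ-distrib-minus {suc n} f g = trans
  (cong (_+_ (f zero - g zero)) (Σ-distrib-minus (f ∘ suc) (g ∘ suc)))
  (regroup (f zero) (g zero) (Σ[< n ] (f ∘ suc)) (Σ[< n ] (g ∘ suc)))
  where
  regroup : ∀ a b c d → (a - b) + (c - d) ≡ (a + c) - (b + d)
  regroup = solve-∀

Σ-split : ∀ r {k} (f : Fin (r ℕ.+ k) → ℤ) →
          Σ[< r ℕ.+ k ] f ≡ Σ[< r ] (λ i → f (i ↑ˡ k)) + Σ[< k ] (λ i → f (r ↑ʳ i))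
Σ-split zero f = sym (ℤ.+-identityˡ _)
Σ-split (suc r) f = trans (cong (_+_ (f zero)) (Σ-split r (f ∘ suc))) (sym (ℤ.+-assoc (f zero) _ _))

Σ-single : ∀ {n} (f : Fin n → ℤ) j → (∀ i → i ≢ j → f i ≡ + 0) → Σ[< n ] f ≡ f j
Σ-single {suc n} f zero f≡0 =
  trans (cong (_+_ (f zero)) (trans (Σ-cong λ i → f≡0 (suc i) λ ()) (Σ-zero n))) (ℤ.+-identityʳ _)
Σ-single {suc n} f (suc j) f≡0 = trans
  (cong (_+ Σ[< n ] (f ∘ suc)) (f≡0 zero λ ()))
  (trans (ℤ.+-identityˡ _) (Σ-single (f ∘ suc) j λ i i≢j → f≡0 (suc i) (i≢j ∘ suc-injective)))

Σ-cong-mod : ∀ {n d} {f g : Fin n → ℤ} → (∀ i → f i ≡ g i [mod d ]) → Σ[< n ] f ≡ Σ[< n ] g [mod d ]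
Σ-cong-mod {zero} f≡g = mod-refl
Σ-cong-mod {suc n} f≡g = mod-+-cong (f≡g zero) (Σ-cong-mod (f≡g ∘ suc))

infixl 6 _-ᵥ_

0ᵥ : ∀ {m} → RowVec m
0ᵥ _ = + 0

_-ᵥ_ : ∀ {m} → RowVec m → RowVec m → RowVec m
(u -ᵥ v) j = u j - v j

module _ {n c : ℕ} where

  ·ᵥ-congˡ : ∀ {p p′ : RowVec n} (A : Matrix n c) → p ≗ p′ → p ·ᵥ A ≗ p′ ·ᵥ A
  ·ᵥ-congˡ A p≗p′ j = Σ-cong λ l → cong (_* A l j) (p≗p′ l)

  ·ᵥ-congʳ : ∀ (p : RowVec n) {A B : Matrix n c} → A ≋ B → p ·ᵥ A ≗ p ·ᵥ B
  ·ᵥ-congʳ p A≋B j = Σ-cong λ l → cong (p l *_) (A≋B l j)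

  ·ᵥ-distribʳ--ᵥ : ∀ (u v : RowVec n) (A : Matrix n c) → (u -ᵥ v) ·ᵥ A ≗ u ·ᵥ A -ᵥ v ·ᵥ A
  ·ᵥ-distribʳ--ᵥ u v A j = trans
    (Σ-cong λ l → distrib (u l) (v l) (A l j))
    (Σ-distrib-minus (λ l → u l * A l j) (λ l → v l * A l j))
    where
    distrib : ∀ x y a → (x - y) * a ≡ x * a - y * a
    distrib = solve-∀

  ·ᵥ-zeroˡ : ∀ (A : Matrix n c) → 0ᵥ ·ᵥ A ≗ 0ᵥ
  ·ᵥ-zeroˡ A j = trans (Σ-cong λ l → ℤ.*-zeroˡ (A l j)) (Σ-zero n)

  ·ᵥ-zeroʳ : ∀ (p : RowVec n) → p ·ᵥ O {n} {c} ≗ 0ᵥ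
  ·ᵥ-zeroʳ p j = trans (Σ-cong λ l → ℤ.*-zeroʳ (p l)) (Σ-zero n)

·ᵥ-assoc : ∀ {n k c} (p : RowVec n) (A : Matrix n k) (B : Matrix k c) → p ·ᵥ (A ⊗ B) ≗ (p ·ᵥ A) ·ᵥ B
·ᵥ-assoc {n} {k} p A B j = begin
  Σ[< n ] (λ l → p l * Σ[< k ] (λ t → A l t * B t j))
    ≡⟨ Σ-cong (λ l → cong (p l *_) (Σ≡sum {k} (λ t → A l t * B t j))) ⟩
  Σ[< n ] (λ l → p l * sum (λ t → A l t * B t j))
    ≡⟨ Σ-cong (λ l → *-distribˡ-sum (p l) (λ t → A l t * B t j)) ⟩
  Σ[< n ] (λ l → sum (λ t → p l * (A l t * B t j)))
    ≡⟨ Σ≡sum {n} (λ l → sum (λ t → p l * (A l t * B t j))) ⟩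
  sum (λ l → sum (λ t → p l * (A l t * B t j)))
    ≡⟨ ∑-comm (λ l t → p l * (A l t * B t j)) ⟩
  sum (λ t → sum (λ l → p l * (A l t * B t j)))
    ≡⟨ sum-cong-≗ (λ t → sum-cong-≗ λ l → ℤ.*-assoc (p l) (A l t) (B t j)) ⟨
  sum (λ t → sum (λ l → p l * A l t * B t j))
    ≡⟨ sum-cong-≗ (λ t → *-distribʳ-sum (B t j) (λ l → p l * A l t)) ⟨
  sum (λ t → sum (λ l → p l * A l t) * B t j)
    ≡⟨ Σ≡sum {k} (λ t → sum (λ l → p l * A l t) * B t j) ⟨
  Σ[< k ] (λ t → sum (λ l → p l * A l t) * B t j)
    ≡⟨ Σ-cong (λ t → cong (_* B t j) (Σ≡sum {n} (λ l → p l * A l t))) ⟨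
  Σ[< k ] (λ t → Σ[< n ] (λ l → p l * A l t) * B t j) ∎
  where open ≡-Reasoning

diag-≢ : ∀ {m} (d : Fin m → ℤ) {i j} → i ≢ j → diag d i j ≡ + 0
diag-≢ d {i} {j} i≢j with i Fin.≟ j
... | yes i≡j = contradiction i≡j i≢j
... | no _ = refl

diag-≡ : ∀ {m} (d : Fin m → ℤ) j → diag d j j ≡ d j
diag-≡ d j with j Fin.≟ j
... | yes _ = refl
... | no j≢j = contradiction refl j≢j

·ᵥ-diag : ∀ {m} (p : RowVec m) (d : Fin m → ℤ) → p ·ᵥ diag d ≗ λ j → p j * d j
·ᵥ-diag p d j = trans
  (Σ-single _ j λ i i≢j → trans (cong (p i *_) (diag-≢ d i≢j)) (ℤ.*-zeroʳ (p i)))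
  (cong (p j *_) (diag-≡ d j))

·ᵥ-identityʳ : ∀ {m} (p : RowVec m) → p ·ᵥ I ≗ p
·ᵥ-identityʳ p j = trans (·ᵥ-diag p _ j) (ℤ.*-identityʳ (p j))

·ᵥ-inverseʳ : ∀ {m c} (V : Matrix m c) (V′ : Matrix c m) → (V ⊗ V′) ≋ I → ∀ a → (a ·ᵥ V) ·ᵥ V′ ≗ a
·ᵥ-inverseʳ V V′ VV′≋I a j =
  trans (sym (·ᵥ-assoc a V V′ j)) (trans (·ᵥ-congʳ a VV′≋I j) (·ᵥ-identityʳ a j))

·ᵥ-stack : ∀ {r k c} (q : RowVec (r ℕ.+ k)) (A : Matrix r c) (B : Matrix k c) j →
           (q ·ᵥ stack A B) j ≡ (take r q ·ᵥ A) j + (drop r q ·ᵥ B) j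
·ᵥ-stack {r} q A B j = trans (Σ-split r _) (cong₂ _+_
  (Σ-cong λ i → cong (q (i ↑ˡ _) *_) (lookup-++ˡ (λ a → A a j) (λ b → B b j) i))
  (Σ-cong λ i → cong (q (r ↑ʳ i) *_) (lookup-++ʳ (λ a → A a j) (λ b → B b j) i)))

-- Column-wise congruences modulo s

infix 4 _≡_[cmod_]

_≡_[cmod_] : ∀ {m} → RowVec m → RowVec m → (Fin m → ℕ) → Set
u ≡ v [cmod s ] = ∀ j → u j ≡ v j [mod s j ]

cmod-≡0⇔ : ∀ {m} {s : Fin m → ℕ} {u u′ : RowVec m} →
           u ≡ u′ [cmod s ] → (u ≡ 0ᵥ [cmod s ] ⇔ u′ ≡ 0ᵥ [cmod s ])
cmod-≡0⇔ u≡u′ = mk⇔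
  (λ u≡0 j → mod-trans (mod-sym (u≡u′ j)) (u≡0 j))
  (λ u′≡0 j → mod-trans (u≡u′ j) (u′≡0 j))

colCong⇒cmod : ∀ {r m} {X Y : Matrix r m} {s : Fin m → ℕ} → ColCong X Y s → ∀ i → X i ≡ Y i [cmod s ]
colCong⇒cmod {X = X} {Y} {s} X≡Y i j = x-y≡0⇒x≡y (≡[mod] quotient (trans equality (sym (ℤ.+-identityˡ _))))
  where open Signed._∣_ (Signed.∣ᵤ⇒∣ {+ s j} {X i j - Y i j} (X≡Y i j))

colmod-≡ : ∀ {r m} {s : Fin m → ℕ} → (∀ j → 0 ℕ.< s j) → ∀ (X : Matrix r m) i → colmod X s i ≡ X i [cmod s ]
colmod-≡ s>0 X i j = modz-≡ (s>0 j) (X i j)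

·ᵥ-congʳ-cmod : ∀ {n c} (p : RowVec n) {A B : Matrix n c} {s} →
                (∀ l → A l ≡ B l [cmod s ]) → p ·ᵥ A ≡ p ·ᵥ B [cmod s ]
·ᵥ-congʳ-cmod p A≡B j = Σ-cong-mod λ l → mod-*-congˡ (p l) (A≡B l j)

·ᵥ-colmod : ∀ {r m c} {s : Fin c → ℕ} → (∀ j → 0 ℕ.< s j) →
            ∀ (x : RowVec r) (A : Matrix r m) (W : Matrix m c) →
            x ·ᵥ colmod (A ⊗ W) s ≡ (x ·ᵥ A) ·ᵥ W [cmod s ]
·ᵥ-colmod s>0 x A W j =
  mod-trans (·ᵥ-congʳ-cmod x (colmod-≡ s>0 (A ⊗ W)) j) (mod-reflexive (·ᵥ-assoc x A W j))

·ᵥ-distribʳ--ᵥ-colmod : ∀ {n k m c} {s : Fin c → ℕ} → (∀ j → 0 ℕ.< s j) →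
  ∀ (p : RowVec n) (F : Matrix n m) (q : RowVec k) (B : Matrix k m) (W : Matrix m c) →
  (p ·ᵥ F -ᵥ q ·ᵥ B) ·ᵥ W ≡ p ·ᵥ colmod (F ⊗ W) s -ᵥ q ·ᵥ colmod (B ⊗ W) s [cmod s ]
·ᵥ-distribʳ--ᵥ-colmod s>0 p F q B W j = mod-trans
  (mod-reflexive (·ᵥ-distribʳ--ᵥ (p ·ᵥ F) (q ·ᵥ B) W j))
  (mod-sym (mod-minus-cong (·ᵥ-colmod s>0 p F W j) (·ᵥ-colmod s>0 q B W j)))

-- Row lattices

infix 4 _∈ℒ_

_∈ℒ_ : ∀ {r c} → RowVec c → Matrix r c → Set
_∈ℒ_ {r} v M = Σ (RowVec r) λ q → v ≗ q ·ᵥ M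

∈ℒ-diagℕ⇔ : ∀ {m} {s : Fin m → ℕ} {u : RowVec m} → u ∈ℒ diagℕ s ⇔ u ≡ 0ᵥ [cmod s ]
∈ℒ-diagℕ⇔ {s = s} {u} = mk⇔
  (λ (t , u≗tS) j → ≡[mod] (t j) (trans (u≗tS j) (trans (·ᵥ-diag t _ j) (sym (ℤ.+-identityˡ _)))))
  (λ u≡0 → (λ j → quotient (u≡0 j)) , λ j → trans (equality (u≡0 j))
    (trans (ℤ.+-identityˡ _) (sym (·ᵥ-diag (λ j → quotient (u≡0 j)) (λ j → + s j) j))))
  where open _≡_[mod_]

∈ℒ-stack⇔ : ∀ {r k c} {A : Matrix r c} {B : Matrix k c} {v : RowVec c} →
            v ∈ℒ stack A B ⇔ (∃[ q₂ ] v -ᵥ q₂ ·ᵥ B ∈ℒ A)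
∈ℒ-stack⇔ {r} {A = A} {B} {v} = mk⇔
  (λ (q , v≗qAB) → drop r q , take r q , λ j → x≡a+b⇒x-b≡a (trans (v≗qAB j) (·ᵥ-stack q A B j)))
  (λ (q₂ , q₁ , v-q₂B≗q₁A) → q₁ ++ q₂ , λ j → trans (x-b≡a⇒x≡a+b (v-q₂B≗q₁A j)) (sym (begin
    ((q₁ ++ q₂) ·ᵥ stack A B) j                             ≡⟨ ·ᵥ-stack (q₁ ++ q₂) A B j ⟩
    (take r (q₁ ++ q₂) ·ᵥ A) j + (drop r (q₁ ++ q₂) ·ᵥ B) j ≡⟨ cong₂ _+_
                                                                 (·ᵥ-congˡ A (lookup-++ˡ q₁ q₂) j)
                                                                 (·ᵥ-congˡ B (lookup-++ʳ q₁ q₂) j) ⟩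
    (q₁ ·ᵥ A) j + (q₂ ·ᵥ B) j                               ∎)))
  where
  open ≡-Reasoning
  x≡a+b⇒x-b≡a : ∀ {x a b} → x ≡ a + b → x - b ≡ a
  x≡a+b⇒x-b≡a {a = a} {b} refl = cancel a b
    where
    cancel : ∀ a b → (a + b) - b ≡ a
    cancel = solve-∀
  x-b≡a⇒x≡a+b : ∀ {x a b} → x - b ≡ a → x ≡ a + b
  x-b≡a⇒x≡a+b {x} {b = b} refl = regroup x b
    where
    regroup : ∀ x b → x ≡ (x - b) + b
    regroup = solve-∀

·ᵥ-reflects-∈ℒ : ∀ {r m} {M : Matrix r m} {D : Matrix m m} (U : Matrix m r) (V V′ : Matrix m m) →
                 ((U ⊗ M) ⊗ V) ≋ D → (V ⊗ V′) ≋ I → ∀ {v} → v ·ᵥ V ∈ℒ D → v ∈ℒ M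
·ᵥ-reflects-∈ℒ {M = M} {D} U V V′ UMV≋D VV′≋I {v} (t , vV≗tD) = t ·ᵥ U , λ j → begin
  v j                              ≡⟨ ·ᵥ-inverseʳ V V′ VV′≋I v j ⟨
  ((v ·ᵥ V) ·ᵥ V′) j               ≡⟨ ·ᵥ-congˡ V′ vV≗tD j ⟩
  ((t ·ᵥ D) ·ᵥ V′) j               ≡⟨ ·ᵥ-congˡ V′ (·ᵥ-congʳ t UMV≋D) j ⟨
  ((t ·ᵥ ((U ⊗ M) ⊗ V)) ·ᵥ V′) j   ≡⟨ ·ᵥ-congˡ V′ (·ᵥ-assoc t (U ⊗ M) V) j ⟩
  (((t ·ᵥ (U ⊗ M)) ·ᵥ V) ·ᵥ V′) j  ≡⟨ ·ᵥ-inverseʳ V V′ VV′≋I (t ·ᵥ (U ⊗ M)) j ⟩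
  (t ·ᵥ (U ⊗ M)) j                 ≡⟨ ·ᵥ-assoc t U M j ⟩
  ((t ·ᵥ U) ·ᵥ M) j                ∎
  where open ≡-Reasoning

·ᵥ-resp-cmod : ∀ {m c} {s : Fin m → ℕ} {s′ : Fin c → ℕ} (X : Matrix m c) →
               (∀ l → (diagℕ s ⊗ X) l ≡ 0ᵥ [cmod s′ ]) →
               ∀ {u u′} → u ≡ u′ [cmod s ] → u ·ᵥ X ≡ u′ ·ᵥ X [cmod s′ ]
·ᵥ-resp-cmod {s = s} {s′} X SX≡0 {u} {u′} u≡u′ j =
  let t , u-u′≗tS = Equivalence.from ∈ℒ-diagℕ⇔ (x≡y⇒x-y≡0 ∘ u≡u′) in
  x-y≡0⇒x≡y (begin
    (u ·ᵥ X) j - (u′ ·ᵥ X) j   ≡⟨ ·ᵥ-distribʳ--ᵥ u u′ X j ⟨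
    ((u -ᵥ u′) ·ᵥ X) j         ≡⟨ ·ᵥ-congˡ X u-u′≗tS j ⟩
    ((t ·ᵥ diagℕ s) ·ᵥ X) j    ≡⟨ ·ᵥ-assoc t (diagℕ s) X j ⟨
    (t ·ᵥ (diagℕ s ⊗ X)) j     ≈⟨ ·ᵥ-congʳ-cmod t {B = O} SX≡0 j ⟩
    (t ·ᵥ O) j                 ≡⟨ ·ᵥ-zeroʳ t j ⟩
    + 0                        ∎)
  where open ≈-Reasoning (mod-setoid {s′ j})

-- Finiteness of ℤᵐ modulo s

residue : ∀ d .{{_ : NonZero d}} → ℤ → Fin d
residue d x = fromℕ< (n%ℕd<d x d)

module _ {d : ℕ} .{{_ : NonZero d}} where

  mod-residue : ∀ x → x ≡ + toℕ (residue d x) [mod d ]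
  mod-residue x = subst (λ r → x ≡ + r [mod d ]) (sym (toℕ-fromℕ< (n%ℕd<d x d))) (mod-%ℕ x)

  residue-cong : ∀ {x y} → x ≡ y [mod d ] → residue d x ≡ residue d y
  residue-cong {x} {y} x≡y = toℕ-injective (residue-unique (toℕ<n (residue d x)) (toℕ<n (residue d y))
    (mod-trans (mod-sym (mod-residue x)) (mod-trans x≡y (mod-residue y))))

  residue-toℕ : ∀ (a : Fin d) → residue d (+ toℕ a) ≡ a
  residue-toℕ a = toℕ-injective (trans (toℕ-fromℕ< (n%ℕd<d (+ toℕ a) d)) (m<n⇒m%n≡m (toℕ<n a)))

∏ : ∀ {m} → (Fin m → ℕ) → ℕ
∏ = foldr ℕ._*_ 1

encode : ∀ {m} (s : Fin m → ℕ) → (∀ j → 0 ℕ.< s j) → RowVec m → Fin (∏ s)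
encode {zero} s s>0 u = zero
encode {suc m} s s>0 u =
  combine (residue (s zero) {{ℕ.>-nonZero (s>0 zero)}} (u zero)) (encode (s ∘ suc) (s>0 ∘ suc) (u ∘ suc))

decode : ∀ {m} (s : Fin m → ℕ) → Fin (∏ s) → RowVec m
decode {zero} s i ()
decode {suc m} s i = + toℕ (proj₁ digits) ∷ decode (s ∘ suc) (proj₂ digits)
  where digits = remQuot {s zero} (∏ (s ∘ suc)) i

encode-decode : ∀ {m} (s : Fin m → ℕ) s>0 (i : Fin (∏ s)) → encode s s>0 (decode s i) ≡ i
encode-decode {zero} s s>0 zero = refl
encode-decode {suc m} s s>0 i = trans
  (cong₂ combine (residue-toℕ {{ℕ.>-nonZero (s>0 zero)}} _) (encode-decode (s ∘ suc) (s>0 ∘ suc) _))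
  (combine-remQuot {s zero} (∏ (s ∘ suc)) i)

decode-encode : ∀ {m} (s : Fin m → ℕ) s>0 (u : RowVec m) → decode s (encode s s>0 u) ≡ u [cmod s ]
decode-encode {suc m} s s>0 u j =
  subst (λ (a , b) → (+ toℕ a ∷ decode (s ∘ suc) b) j ≡ u j [mod s j ])
        (sym (remQuot-combine {s zero} {∏ (s ∘ suc)} r e)) (digit j)
  where
  r = residue (s zero) {{ℕ.>-nonZero (s>0 zero)}} (u zero)
  e = encode (s ∘ suc) (s>0 ∘ suc) (u ∘ suc)
  digit : ∀ j → (+ toℕ r ∷ decode (s ∘ suc) e) j ≡ u j [mod s j ]
  digit zero = mod-sym (mod-residue {{ℕ.>-nonZero (s>0 zero)}} (u zero))
  digit (suc j) = decode-encode (s ∘ suc) (s>0 ∘ suc) (u ∘ suc) j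

encode-cong : ∀ {m} (s : Fin m → ℕ) s>0 {u u′ : RowVec m} →
              u ≡ u′ [cmod s ] → encode s s>0 u ≡ encode s s>0 u′
encode-cong {zero} s s>0 u≡u′ = refl
encode-cong {suc m} s s>0 u≡u′ = cong₂ combine
  (residue-cong {{ℕ.>-nonZero (s>0 zero)}} (u≡u′ zero))
  (encode-cong (s ∘ suc) (s>0 ∘ suc) (u≡u′ ∘ suc))

encode-injective : ∀ {m} (s : Fin m → ℕ) s>0 {u u′ : RowVec m} →
                   encode s s>0 u ≡ encode s s>0 u′ → u ≡ u′ [cmod s ]
encode-injective s s>0 {u} {u′} eq j = mod-trans
  (mod-sym (decode-encode s s>0 u j))
  (subst (λ i → decode s i j ≡ u′ j [mod s j ]) (sym eq) (decode-encode s s>0 u′ j))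

injective⇒surjective : ∀ {n} {f : Fin n → Fin n} → Injective _≡_ _≡_ f → ∀ j → ∃[ i ] f i ≡ j
injective⇒surjective {suc n} {f} f-inj j with any? (λ i → f i Fin.≟ j)
... | yes hit = hit
... | no miss = contradiction (injective⇒≤ punchOut-inj) (ℕ.<-irrefl refl)
  where
  j≢f : ∀ i → j ≢ f i
  j≢f i j≡fi = miss (i , sym j≡fi)
  punchOut-inj : Injective _≡_ _≡_ (λ i → punchOut (j≢f i))
  punchOut-inj {a} {b} eq = f-inj (punchOut-injective (j≢f a) (j≢f b) eq)

leftInverse⇒injective : ∀ {A B : Set} {f : B → A} {g : A → B} → (∀ a → f (g a) ≡ a) → Injective _≡_ _≡_ g
leftInverse⇒injective {f = f} fg≡id {a} {b} ga≡gb = trans (sym (fg≡id a)) (trans (cong f ga≡gb) (fg≡id b))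

rightInverse⇒injective : ∀ {n} {f g : Fin n → Fin n} → (∀ i → f (g i) ≡ i) → Injective _≡_ _≡_ f
rightInverse⇒injective {f = f} {g} fg≡id {a} {b} fa≡fb
  with a′ , refl ← injective⇒surjective (leftInverse⇒injective {f = f} {g} fg≡id) a
     | b′ , refl ← injective⇒surjective (leftInverse⇒injective {f = f} {g} fg≡id) b
  = cong g (trans (sym (fg≡id a′)) (trans fa≡fb (fg≡id b′)))

cmod-rightInverse⇒injective : ∀ {m} {s : Fin m → ℕ} → (∀ j → 0 ℕ.< s j) →
  ∀ {f g : RowVec m → RowVec m} →
  (∀ {u u′} → u ≡ u′ [cmod s ] → f u ≡ f u′ [cmod s ]) →
  (∀ u → f (g u) ≡ u [cmod s ]) →
  ∀ {u u′} → f u ≡ f u′ [cmod s ] → u ≡ u′ [cmod s ]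
cmod-rightInverse⇒injective {s = s} s>0 {f} {g} f-cong fg≡id {u} {u′} fu≡fu′ =
  encode-injective s s>0 (rightInverse⇒injective {f = F} {G} FG≡id (begin
    F (enc u)   ≡⟨ encode-cong s s>0 (f-cong (decode-encode s s>0 u)) ⟩
    enc (f u)   ≡⟨ encode-cong s s>0 fu≡fu′ ⟩
    enc (f u′)  ≡⟨ encode-cong s s>0 (f-cong (decode-encode s s>0 u′)) ⟨
    F (enc u′)  ∎))
  where
  open ≡-Reasoning
  enc = encode s s>0
  F G : Fin (∏ s) → Fin (∏ s)
  F = enc ∘ f ∘ decode s
  G = enc ∘ g ∘ decode s
  FG≡id : ∀ i → F (G i) ≡ i
  FG≡id i = trans
    (encode-cong s s>0 λ j → mod-trans (f-cong (decode-encode s s>0 (g (decode s i))) j) (fg≡id (decode s i) j))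
    (encode-decode s s>0 i)

-- Smith massagers

module Massager {m} {M₁ U V V′ W Z : Matrix m m} {s : Fin m → ℕ} (s>0 : ∀ j → 0 ℕ.< s j)
  (UM₁V≋S : ((U ⊗ M₁) ⊗ V) ≋ diagℕ s) (VV′≋I : (V ⊗ V′) ≋ I)
  (M₁W≡0 : ∀ i → (M₁ ⊗ W) i ≡ 0ᵥ [cmod s ]) (ZW≡I : ∀ i → (Z ⊗ W) i ≡ I i [cmod s ]) where

  private
    -- In the coordinates w = vV of the Smith form, v ↦ vW becomes w ↦ wX.
    X Y : Matrix m m
    X = V′ ⊗ W
    Y = Z ⊗ V

    ·V·X≗·W : ∀ a → (a ·ᵥ V) ·ᵥ X ≗ a ·ᵥ W
    ·V·X≗·W a j = trans (·ᵥ-assoc (a ·ᵥ V) V′ W j) (·ᵥ-congˡ W (·ᵥ-inverseʳ V V′ VV′≋I a) j)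

    ·M₁W≡0 : ∀ q → (q ·ᵥ M₁) ·ᵥ W ≡ 0ᵥ [cmod s ]
    ·M₁W≡0 q j = begin
      ((q ·ᵥ M₁) ·ᵥ W) j  ≡⟨ ·ᵥ-assoc q M₁ W j ⟨
      (q ·ᵥ (M₁ ⊗ W)) j   ≈⟨ ·ᵥ-congʳ-cmod q {B = O} M₁W≡0 j ⟩
      (q ·ᵥ O) j          ≡⟨ ·ᵥ-zeroʳ q j ⟩
      + 0                 ∎
      where open ≈-Reasoning (mod-setoid {s j})

    SX≡0 : ∀ l → (diagℕ s ⊗ X) l ≡ 0ᵥ [cmod s ]
    SX≡0 l j = begin
      (diagℕ s l ·ᵥ X) j           ≡⟨ ·ᵥ-congˡ X (λ i → sym (UM₁V≋S l i)) j ⟩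
      (((U l ·ᵥ M₁) ·ᵥ V) ·ᵥ X) j  ≡⟨ ·V·X≗·W (U l ·ᵥ M₁) j ⟩
      ((U l ·ᵥ M₁) ·ᵥ W) j         ≈⟨ ·M₁W≡0 (U l) j ⟩
      + 0                          ∎
      where open ≈-Reasoning (mod-setoid {s j})

    YX≡id : ∀ c → (c ·ᵥ Y) ·ᵥ X ≡ c [cmod s ]
    YX≡id c j = begin
      ((c ·ᵥ (Z ⊗ V)) ·ᵥ X) j   ≡⟨ ·ᵥ-congˡ X (·ᵥ-assoc c Z V) j ⟩
      (((c ·ᵥ Z) ·ᵥ V) ·ᵥ X) j  ≡⟨ ·V·X≗·W (c ·ᵥ Z) j ⟩
      ((c ·ᵥ Z) ·ᵥ W) j         ≡⟨ ·ᵥ-assoc c Z W j ⟨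
      (c ·ᵥ (Z ⊗ W)) j          ≈⟨ ·ᵥ-congʳ-cmod c ZW≡I j ⟩
      (c ·ᵥ I) j                ≡⟨ ·ᵥ-identityʳ c j ⟩
      c j                       ∎
      where open ≈-Reasoning (mod-setoid {s j})

    ·X-reflects-0 : ∀ {w} → w ·ᵥ X ≡ 0ᵥ [cmod s ] → w ≡ 0ᵥ [cmod s ]
    ·X-reflects-0 wX≡0 = cmod-rightInverse⇒injective s>0 {f = _·ᵥ X} {g = _·ᵥ Y}
      (·ᵥ-resp-cmod X SX≡0) YX≡id λ j → mod-trans (wX≡0 j) (mod-reflexive (sym (·ᵥ-zeroˡ X j)))

  ∈ℒ⇔ : ∀ {v} → v ∈ℒ M₁ ⇔ v ·ᵥ W ≡ 0ᵥ [cmod s ]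
  ∈ℒ⇔ {v} = mk⇔
    (λ (q , v≗qM₁) j → mod-trans (mod-reflexive (·ᵥ-congˡ W v≗qM₁ j)) (·M₁W≡0 q j))
    (λ vW≡0 → ·ᵥ-reflects-∈ℒ U V V′ UM₁V≋S VV′≋I (Equivalence.from ∈ℒ-diagℕ⇔
      (·X-reflects-0 λ j → mod-trans (mod-reflexive (·V·X≗·W v j)) (vW≡0 j))))

∈ℒ-massager⇔ : ∀ {m} {M₁ : Matrix m m} {s : Fin m → ℕ} {W : Matrix m m} →
               IsSmithForm M₁ s → IsSmithMassager M₁ s W → ∀ {v} → v ∈ℒ M₁ ⇔ v ·ᵥ W ≡ 0ᵥ [cmod s ]
∈ℒ-massager⇔ {M₁ = M₁} {W = W} (s>0 , _ , U , V , _ , (V′ , VV′≋I , _) , UM₁V≋S) (M₁W≡0 , Z , ZW≡I) =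
  Massager.∈ℒ⇔ {M₁ = M₁} {U} {V} {V′} {W} {Z} s>0 UM₁V≋S VV′≋I (colCong⇒cmod M₁W≡0) (colCong⇒cmod ZW≡I)

lemma17 : ∀ {m k n} (M₁ : Matrix m m) (M₂ : Matrix k m) (F : Matrix n m)
            (s : Fin m → ℕ) (W : Matrix m m) →
            Nonsingular M₁ → IsSmithForm M₁ s → IsSmithMassager M₁ s W →
            ∀ (p : RowVec n) →
            InR (stack M₁ M₂) F p ⇔
              InR (stack (diagℕ s) (colmod (M₂ ⊗ W) s)) (colmod (F ⊗ W) s) p
lemma17 {k = k} M₁ M₂ F s W _ smith massager p = begin
  p ·ᵥ F ∈ℒ stack M₁ M₂                            ≈⟨ ∈ℒ-stack⇔ ⟩
  (∃[ q ] p ·ᵥ F -ᵥ q ·ᵥ M₂ ∈ℒ M₁)                  ≈⟨ under-∃ (∈ℒ-massager⇔ smith massager) ⟩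
  (∃[ q ] (p ·ᵥ F -ᵥ q ·ᵥ M₂) ·ᵥ W ≡ 0ᵥ [cmod s ])  ≈⟨ under-∃ (λ {q} → cmod-≡0⇔ (reduce q)) ⟩
  (∃[ q ] p ·ᵥ CF -ᵥ q ·ᵥ C₂ ≡ 0ᵥ [cmod s ])        ≈⟨ under-∃ ∈ℒ-diagℕ⇔ ⟨
  (∃[ q ] p ·ᵥ CF -ᵥ q ·ᵥ C₂ ∈ℒ diagℕ s)            ≈⟨ ∈ℒ-stack⇔ ⟨
  p ·ᵥ CF ∈ℒ stack (diagℕ s) C₂                    ∎
  where
  open ≈-Reasoning (⇔-setoid 0ℓ)
  under-∃ : ∀ {A B : RowVec k → Set} → (∀ {q} → A q ⇔ B q) → (∃[ q ] A q) ⇔ (∃[ q ] B q)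
  under-∃ = Σ-⇔ (↠-id _)
  CF = colmod (F ⊗ W) s
  C₂ = colmod (M₂ ⊗ W) s
  reduce = λ q → ·ᵥ-distribʳ--ᵥ-colmod (proj₁ smith) p F q M₂ W
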